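{- Let $G$ be a graph on $n$ vertices that contains neither $C_4$ nor $D_4$ as an induced subgraph. Then (a) any two distinct maximal cliques of $G$ intersect in at most one vertex, and (b) the number of maximal cliques of $G$ is at most $n^2$.
   Context: $C_4$ is the cycle on four vertices and $D_4=K_4-e$ is the complete graph on four vertices with one edge removed. -}

module Defs where

open import Level using (0ℓ)
open import Data.Nat using (ℕ)
open import Data.Fin using (Fin)
open import Data.Fin.Subset using (Subset; _∈_; _⊆_; Nonempty)
open import Data.Product using (_×_; ∃)
open import Relation.Nullary using (¬_)
open import Relation.Binary.PropositionalEquality using (_≡_; _≢_)

record Graph (n : ℕ) : Set₁ where
  field
    Adj     : Fin n → Fin n → Set
    symm    : ∀ {u v} → Adj u v → Adj v u
    irrefl  : ∀ {u} → ¬ Adj u u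
open Graph public

module _ {n : ℕ} (G : Graph n) where

  IsClique : Subset n → Set
  IsClique C = Nonempty C × (∀ u v → u ∈ C → v ∈ C → u ≢ v → Adj G u v)

  IsMaximalClique : Subset n → Set
  IsMaximalClique C = IsClique C × (∀ D → IsClique D → C ⊆ D → D ⊆ C)

  Distinct4 : Fin n → Fin n → Fin n → Fin n → Set
  Distinct4 a b c d =
    a ≢ b × a ≢ c × a ≢ d × b ≢ c × b ≢ d × c ≢ d

  InducedC4 : Fin n → Fin n → Fin n → Fin n → Set
  InducedC4 a b c d =
    Distinct4 a b c d ×
    Adj G a b × Adj G b c × Adj G c d × Adj G d a ×
    ¬ Adj G a c × ¬ Adj G b d

  InducedD4 : Fin n → Fin n → Fin n → Fin n → Set
  InducedD4 a b c d =
    Distinct4 a b c d ×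
    Adj G a b × Adj G b c × Adj G c d × Adj G d a × Adj G b d ×
    ¬ Adj G a c

  C4Free : Set
  C4Free = ∀ a b c d → ¬ InducedC4 a b c d

  D4Free : Set
  D4Free = ∀ a b c d → ¬ InducedD4 a b c d

-- If two distinct maximal cliques C and D shared an edge uv, pick c ∈ C ∖ D.
-- By maximality of D some d ∈ D is not adjacent to c, and d ∉ {u, v} since
-- c is adjacent to both; but then c, u, d, v induce a D4 (missing edge cd).
-- So a maximal clique is determined by any of its edges, or by its vertex if
-- it is a single vertex, which gives an injection into pairs of vertices.
module Submission where

open import Defs
open import Data.Nat as ℕ using (ℕ; _≤_; _^_; _*_; z≤n; s≤s)
open import Data.Nat.Properties using (≤-trans; ≤-reflexive; _≤?_; ≰⇒>; *-identityʳ)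
open import Data.Fin using (Fin; zero; suc; _<_; combine)
open import Data.Fin.Properties using (_≟_; any?; pigeonhole; combine-injective)
open import Data.Fin.Subset using (Subset; _∈_; _⊆_; _∪_; _∩_; ⁅_⁆; ∣_∣; Nonempty)
open import Data.Fin.Subset.Properties
  using (_∈?_; ⊆-antisym; x∈⁅x⁆; x∈⁅y⁆⇒x≡y; ∣⁅x⁆∣≡1; ∣⊥∣≡0; Empty-unique;
         p⊆q⇒∣p∣≤∣q∣; p⊆p∪q; q⊆p∪q; x∈p∪q⁻; x∈p∩q⁻)
open import Data.List using (List; length; lookup)
open import Data.List.Membership.Propositional.Properties using (∈-lookup)
open import Data.List.Relation.Unary.All as All using (All)
open import Data.List.Relation.Unary.AllPairs using (_∷_)
open import Data.List.Relation.Unary.Unique.Propositional using (Unique)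
open import Data.Product using (_×_; _,_; proj₁; ∃₂)
open import Data.Sum using (_⊎_; inj₁; inj₂)
open import Data.Empty using (⊥-elim)
open import Relation.Nullary using (¬_; yes; no; contradiction)
open import Relation.Nullary.Decidable using (_×-dec_; ¬?)
open import Relation.Binary.PropositionalEquality
  using (_≡_; _≢_; refl; sym; trans; subst; cong)

¬¬-pull-Fin : ∀ {n} {P : Fin n → Set} → (∀ i → ¬ ¬ P i) → ¬ ¬ (∀ i → P i)
¬¬-pull-Fin {ℕ.zero}  ¬¬P ¬∀P = ¬∀P λ ()
¬¬-pull-Fin {ℕ.suc n} ¬¬P ¬∀P =
  ¬¬P zero λ P₀ → ¬¬-pull-Fin (λ i → ¬¬P (suc i))
    λ P₊ → ¬∀P λ { zero → P₀ ; (suc i) → P₊ i }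

¬¬-→ : ∀ {A B : Set} → (A → ¬ ¬ B) → ¬ ¬ (A → B)
¬¬-→ f ¬[A→B] = ¬[A→B] λ a → ⊥-elim (f a λ b → ¬[A→B] λ _ → b)

subsingleton⇒∣p∣≤1 : ∀ {n} {p : Subset n} →
  (∀ {x y} → x ∈ p → y ∈ p → x ≡ y) → ∣ p ∣ ≤ 1
subsingleton⇒∣p∣≤1 {n} {p} unique with any? (_∈? p)
... | no  p-empty rewrite Empty-unique p-empty | ∣⊥∣≡0 n = z≤n
... | yes (u , u∈p) = ≤-trans (p⊆q⇒∣p∣≤∣q∣ p⊆⁅u⁆) (≤-reflexive (∣⁅x⁆∣≡1 u))
  where
  p⊆⁅u⁆ : p ⊆ ⁅ u ⁆
  p⊆⁅u⁆ x∈p = subst (_∈ ⁅ u ⁆) (sym (unique x∈p u∈p)) (x∈⁅x⁆ u)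

Unique⇒lookup-distinct : ∀ {A : Set} {xs : List A} → Unique xs →
  ∀ {i j} → i < j → lookup xs i ≢ lookup xs j
Unique⇒lookup-distinct (x≢xs ∷ _) {zero} {suc j} _ = All.lookup x≢xs (∈-lookup j)
Unique⇒lookup-distinct (_ ∷ uniq) {suc i} {suc j} (s≤s i<j) =
  Unique⇒lookup-distinct uniq i<j

length≤-of-injective-code : ∀ {A : Set} {P : A → Set} {m} {xs : List A} →
  Unique xs → All P xs →
  (code : ∀ {x} → P x → Fin m) →
  (∀ {x y} (p : P x) (q : P y) → code p ≡ code q → x ≡ y) →
  length xs ≤ m
length≤-of-injective-code {m = m} {xs} uniq pxs code code-injective
  with length xs ≤? m
... | yes ≤m = ≤m
... | no  ≰m
  with i , j , i<j , same-code ← pigeonhole (≰⇒> ≰m) (λ i → code (All.lookup pxs (∈-lookup i))) =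
  ⊥-elim (Unique⇒lookup-distinct uniq i<j (code-injective _ _ same-code))

module _ {n : ℕ} (G : Graph n) where

  Adj⇒≢ : ∀ {x y} → Adj G x y → x ≢ y
  Adj⇒≢ xy refl = irrefl G xy

  clique-adj : ∀ {C x y} → IsClique G C → x ∈ C → y ∈ C → x ≢ y → Adj G x y
  clique-adj (_ , adj) x∈C y∈C = adj _ _ x∈C y∈C

  clique-∪-⁅⁆ : ∀ {C c} → IsClique G C → (∀ x → x ∈ C → Adj G c x) →
    IsClique G (⁅ c ⁆ ∪ C)
  clique-∪-⁅⁆ {C} {c} C-clique c~C =
    (c , p⊆p∪q C (x∈⁅x⁆ c)) ,
    λ x y x∈ y∈ x≢y → adj (x∈p∪q⁻ ⁅ c ⁆ C x∈) (x∈p∪q⁻ ⁅ c ⁆ C y∈) x≢y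
    where
    adj : ∀ {x y} → x ∈ ⁅ c ⁆ ⊎ x ∈ C → y ∈ ⁅ c ⁆ ⊎ y ∈ C → x ≢ y → Adj G x y
    adj (inj₁ x∈⁅c⁆) (inj₁ y∈⁅c⁆) x≢y =
      ⊥-elim (x≢y (trans (x∈⁅y⁆⇒x≡y c x∈⁅c⁆) (sym (x∈⁅y⁆⇒x≡y c y∈⁅c⁆))))
    adj (inj₁ x∈⁅c⁆) (inj₂ y∈C) _ with refl ← x∈⁅y⁆⇒x≡y c x∈⁅c⁆ = c~C _ y∈C
    adj (inj₂ x∈C) (inj₁ y∈⁅c⁆) _ with refl ← x∈⁅y⁆⇒x≡y c y∈⁅c⁆ = symm G (c~C _ x∈C)
    adj (inj₂ x∈C) (inj₂ y∈C) x≢y = clique-adj C-clique x∈C y∈C x≢y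

  maximalClique-no-common-neighbour : ∀ {C} c → IsMaximalClique G C →
    ¬ (∀ x → x ∈ C → Adj G c x)
  maximalClique-no-common-neighbour {C} c (C-clique , maximal) c~C =
    irrefl G (c~C c (maximal _ (clique-∪-⁅⁆ C-clique c~C) (q⊆p∪q ⁅ c ⁆ C)
                                 (p⊆p∪q C (x∈⁅x⁆ c))))

  D4Free⇒common-neighbours-adjacent : D4Free G → ∀ {u v c d} →
    Adj G u v → Adj G c u → Adj G c v → Adj G d u → Adj G d v → c ≢ d →
    ¬ ¬ Adj G c d
  D4Free⇒common-neighbours-adjacent d4 {u} {v} {c} {d} uv cu cv du dv c≢d ¬cd =
    d4 c u d v
      ( (Adj⇒≢ cu , c≢d , Adj⇒≢ cv , Adj⇒≢ (symm G du) , Adj⇒≢ uv , Adj⇒≢ dv)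
      , cu , symm G du , dv , symm G cv , uv , ¬cd)

  module _ (d4 : D4Free G) where

    shared-edge⇒⊆ : ∀ {C D u v} → IsClique G C → IsMaximalClique G D →
      u ∈ C → u ∈ D → v ∈ C → v ∈ D → u ≢ v → C ⊆ D
    shared-edge⇒⊆ {C} {D} {u} {v} C-clique D-max u∈C u∈D v∈C v∈D u≢v {c} c∈C
      with c ∈? D
    ... | yes c∈D = c∈D
    -- Adj is not decidable, so the non-neighbour of c in D exists only under ¬¬.
    ... | no  c∉D =
      ⊥-elim (¬¬-pull-Fin (λ x → ¬¬-→ (c~ x))
                (maximalClique-no-common-neighbour c D-max))
      where
      D-clique : IsClique G D
      D-clique = proj₁ D-max

      c≢ : ∀ {x} → x ∈ D → c ≢ x
      c≢ x∈D refl = c∉D x∈D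

      c~u : Adj G c u
      c~u = clique-adj C-clique c∈C u∈C (c≢ u∈D)

      c~v : Adj G c v
      c~v = clique-adj C-clique c∈C v∈C (c≢ v∈D)

      c~ : ∀ x → x ∈ D → ¬ ¬ Adj G c x
      c~ x x∈D with x ≟ u | x ≟ v
      ... | yes refl | _        = contradiction c~u
      ... | no  _    | yes refl = contradiction c~v
      ... | no  x≢u  | no  x≢v  =
        D4Free⇒common-neighbours-adjacent d4
          (clique-adj D-clique u∈D v∈D u≢v) c~u c~v
          (clique-adj D-clique x∈D u∈D x≢u) (clique-adj D-clique x∈D v∈D x≢v)
          (c≢ x∈D)

    shared-edge⇒≡ : ∀ {C D u v} → IsMaximalClique G C → IsMaximalClique G D →
      u ∈ C → u ∈ D → v ∈ C → v ∈ D → u ≢ v → C ≡ D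
    shared-edge⇒≡ C-max D-max u∈C u∈D v∈C v∈D u≢v =
      ⊆-antisym (shared-edge⇒⊆ (proj₁ C-max) D-max u∈C u∈D v∈C v∈D u≢v)
                (shared-edge⇒⊆ (proj₁ D-max) C-max u∈D u∈C v∈D v∈C u≢v)

    maximalCliques-∣∩∣≤1 : ∀ {C D} → IsMaximalClique G C → IsMaximalClique G D →
      C ≢ D → ∣ C ∩ D ∣ ≤ 1
    maximalCliques-∣∩∣≤1 {C} {D} C-max D-max C≢D = subsingleton⇒∣p∣≤1 same
      where
      same : ∀ {x y} → x ∈ C ∩ D → y ∈ C ∩ D → x ≡ y
      same {x} {y} x∈ y∈ with x ≟ y
      ... | yes x≡y = x≡y
      ... | no  x≢y with x∈C , x∈D ← x∈p∩q⁻ C D x∈ | y∈C , y∈D ← x∈p∩q⁻ C D y∈ =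
        ⊥-elim (C≢D (shared-edge⇒≡ C-max D-max x∈C x∈D y∈C y∈D x≢y))

Anchor : ∀ {n} → Subset n → Fin n → Fin n → Set
Anchor C u v = u ∈ C × v ∈ C × (u ≡ v → C ≡ ⁅ u ⁆)

anchor : ∀ {n} {C : Subset n} → Nonempty C → ∃₂ (Anchor C)
anchor {C = C} (u , u∈C) with any? (λ v → v ∈? C ×-dec ¬? (u ≟ v))
... | yes (v , v∈C , u≢v) = u , v , u∈C , v∈C , λ u≡v → ⊥-elim (u≢v u≡v)
... | no  no-other = u , u , u∈C , u∈C , λ _ → ⊆-antisym C⊆⁅u⁆ ⁅u⁆⊆C
  where
  C⊆⁅u⁆ : C ⊆ ⁅ u ⁆
  C⊆⁅u⁆ {x} x∈C with u ≟ x
  ... | yes refl = x∈⁅x⁆ u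
  ... | no  u≢x  = ⊥-elim (no-other (x , x∈C , u≢x))

  ⁅u⁆⊆C : ⁅ u ⁆ ⊆ C
  ⁅u⁆⊆C x∈⁅u⁆ = subst (_∈ C) (sym (x∈⁅y⁆⇒x≡y u x∈⁅u⁆)) u∈C

module _ {n : ℕ} (G : Graph n) (d4 : D4Free G) where

  anchor-injective : ∀ {C D u v} → IsMaximalClique G C → IsMaximalClique G D →
    Anchor C u v → Anchor D u v → C ≡ D
  anchor-injective {u = u} {v} C-max D-max (u∈C , v∈C , C≡⁅u⁆) (u∈D , v∈D , D≡⁅u⁆)
    with u ≟ v
  ... | yes u≡v = trans (C≡⁅u⁆ u≡v) (sym (D≡⁅u⁆ u≡v))
  ... | no  u≢v = shared-edge⇒≡ G d4 C-max D-max u∈C u∈D v∈C v∈D u≢v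

  anchor-code : ∀ {C} → IsMaximalClique G C → Fin (n * n)
  anchor-code C-max with u , v , _ ← anchor (proj₁ (proj₁ C-max)) = combine u v

  anchor-code-injective : ∀ {C D} (C-max : IsMaximalClique G C) (D-max : IsMaximalClique G D) →
    anchor-code C-max ≡ anchor-code D-max → C ≡ D
  anchor-code-injective C-max D-max same-code
    with u , v , C-anchor ← anchor (proj₁ (proj₁ C-max))
       | u′ , v′ , D-anchor ← anchor (proj₁ (proj₁ D-max))
    with refl , refl ← combine-injective u v u′ v′ same-code
    = anchor-injective C-max D-max C-anchor D-anchor

  maximalCliques-length≤n*n : ∀ {Cs} → All (IsMaximalClique G) Cs → Unique Cs →
    length Cs ≤ n * n
  maximalCliques-length≤n*n all-max uniq =
    length≤-of-injective-code uniq all-max anchor-code anchor-code-injective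

lemma6 : (n : ℕ) (G : Graph n) → C4Free G → D4Free G →
    ((C D : Subset n) → IsMaximalClique G C → IsMaximalClique G D → C ≢ D →
      ∣ C ∩ D ∣ ≤ 1)
    × ((Cs : List (Subset n)) → All (IsMaximalClique G) Cs → Unique Cs →
      length Cs ≤ n ^ 2)
lemma6 n G _ d4 =
  (λ C D → maximalCliques-∣∩∣≤1 G d4) ,
  λ Cs all-max uniq →
    subst (length Cs ≤_) (cong (n *_) (sym (*-identityʳ n)))
      (maximalCliques-length≤n*n G d4 all-max uniq)
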